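{- Let $G$ be a graph containing an $s$-clique $A$ and an $r$-clique $B$ with $A$ and $B$ disjoint, such that each vertex in $B$ is adjacent to at least $j$ vertices in $A$, and let $k$ be a positive integer. If $O\!\chi_k(G)<r+s$, then \[ O\!\chi_k(G)\ge \left\lceil r+s+\frac{rj-rs}{k}\right\rceil. \]
   Context: All graphs are finite simple graphs. An $r$-clique is a set of $r$ pairwise adjacent vertices. An $n$-coloring of a graph $G$ is a proper vertex coloring using at most $n$ colors. Two colorings $C_1,C_2$ of $G$ are orthogonal if whenever two distinct vertices share a color in $C_1$, they have distinct colors in $C_2$. The $k$-orthogonal chromatic number $O\!\chi_k(G)$ is the minimum $n$ such that there exist $k$ pairwise orthogonal $n$-colorings of $G$. -}

module Defs where

open import Level using (0ℓ)
open import Data.Nat using (ℕ; _≤_)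
open import Data.Fin using (Fin)
open import Data.Product using (Σ; _×_; ∃)
open import Relation.Nullary using (¬_; Dec)
open import Relation.Binary.PropositionalEquality using (_≡_; _≢_)
open import Function.Definitions using (Injective)

record Graph : Set₁ where
  field
    n     : ℕ
    Adj   : Fin n → Fin n → Set
    sym   : ∀ {u v} → Adj u v → Adj v u
    irrefl : ∀ {u} → ¬ Adj u u
    dec   : ∀ u v → Dec (Adj u v)

open Graph public

Vertex : Graph → Set
Vertex G = Fin (n G)

IsClique : (G : Graph) (r : ℕ) → (Fin r → Vertex G) → Set
IsClique G r f = Injective _≡_ _≡_ f × (∀ i l → i ≢ l → Adj G (f i) (f l))

Coloring : Graph → ℕ → Set
Coloring G c = Vertex G → Fin c

IsProper : (G : Graph) {c : ℕ} → Coloring G c → Set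
IsProper G col = ∀ u v → Adj G u v → col u ≢ col v

Orthogonal : (G : Graph) {c : ℕ} → Coloring G c → Coloring G c → Set
Orthogonal G C₁ C₂ = ∀ u v → u ≢ v → C₁ u ≡ C₁ v → C₂ u ≢ C₂ v

HasOrthColorings : (G : Graph) (k c : ℕ) → Set
HasOrthColorings G k c =
  Σ (Fin k → Coloring G c) λ C →
    (∀ i → IsProper G (C i)) × (∀ i i' → i ≢ i' → Orthogonal G (C i) (C i'))

IsOrthChromatic : (G : Graph) (k N : ℕ) → Set
IsOrthChromatic G k N =
  HasOrthColorings G k N × (∀ c → HasOrthColorings G k c → N ≤ c)

-- We double count the triples (i, a, b)
-- with Cᵢ(A a) = Cᵢ(B b).
--   * Lower bound: each Cᵢ is injective on A and on B, so by pigeonhole the two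
--     colour sets overlap in at least s + r - N colours; hence at least
--     k (s + r - N) triples.
--   * Upper bound: two distinct vertices share a colour in at most one of the
--     orthogonal colourings, and in none if they are adjacent; a vertex of B
--     has at most s - j non-neighbours in A; hence at most r (s - j) triples.
-- This gives k (r + s) + r j ≤ k N + r s in ℕ, which is exactly the statement
-- r + s + (r j - r s) / k ≤ N, and an integer bounds the ceiling of any
-- rational it bounds.
module Submission where

open import Defs
open import Data.Nat using (ℕ; _+_; _*_; _<_; NonZero)
open import Data.Fin using (Fin)
open import Data.Product using (Σ; _×_)
open import Relation.Binary.PropositionalEquality using (_≢_)
open import Function.Definitions using (Injective)
open import Relation.Binary.PropositionalEquality using (_≡_)
open import Data.Integer as ℤ using (ℤ; +_)
open import Data.Rational as ℚ using (ℚ; _/_)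

open import Data.Bool.Base using (if_then_else_)
open import Data.Nat using (zero; suc; _≤_; z≤n; s≤s)
open import Data.Nat.Properties
  using (+-*-semiring; +-comm; +-assoc; +-identityʳ; *-identityˡ; *-identityʳ;
         *-monoˡ-≤; +-mono-≤; +-monoˡ-≤; +-monoʳ-≤; ≤-refl; ≤-reflexive;
         module ≤-Reasoning)
open import Data.Fin using (zero; suc; _≟_)
open import Data.Fin.Properties using (suc-injective)
open import Data.Product using (_,_)
open import Data.Empty using (⊥-elim)
open import Relation.Nullary using (¬_; Dec; yes; no; does)
open import Relation.Nullary.Decidable using (¬?; decidable-stable)
open import Relation.Binary.PropositionalEquality as ≡ using (refl; cong; cong₂; subst₂; module ≡-Reasoning)
open import Algebra.Properties.Semiring.Sum +-*-semiring
  using (sum-syntax; ∑-comm; ∑-distrib-+; sum-cong-≗; *-distribʳ-sum; sum-replicate-zero)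
import Data.Integer.Properties as ℤP
open import Data.Integer.DivMod using (div-pos-is-/ℕ; n<s[n/ℕd]*d)
open import Data.Rational using (↥_; ↧_)
import Data.Rational.Properties as ℚP
open import Data.Rational.Unnormalised as ℚᵘ using (mkℚᵘ; *≡*)
import Data.Rational.Unnormalised.Properties as ℚᵘP
open import Data.Integer.Solver using (module +-*-Solver)

-- Indicator sums over Fin.

𝟙 : {P : Set} → Dec P → ℕ
𝟙 P? = if does P? then 1 else 0

𝟙-yes : {P : Set} (P? : Dec P) → P → 𝟙 P? ≡ 1
𝟙-yes (yes _) _ = refl
𝟙-yes (no ¬p) p = ⊥-elim (¬p p)

𝟙-no : {P : Set} (P? : Dec P) → ¬ P → 𝟙 P? ≡ 0
𝟙-no (yes p) ¬p = ⊥-elim (¬p p)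
𝟙-no (no _) _ = refl

𝟙-¬?-+-𝟙 : {P : Set} (P? : Dec P) → 𝟙 (¬? P?) + 𝟙 P? ≡ 1
𝟙-¬?-+-𝟙 (yes _) = refl
𝟙-¬?-+-𝟙 (no _) = refl

∑-mono : ∀ {n} {f g : Fin n → ℕ} → (∀ i → f i ≤ g i) → ∑[ i < n ] f i ≤ ∑[ i < n ] g i
∑-mono {zero} f≤g = z≤n
∑-mono {suc n} f≤g = +-mono-≤ (f≤g zero) (∑-mono (λ i → f≤g (suc i)))

∑-const : ∀ n c → ∑[ i < n ] c ≡ n * c
∑-const zero c = refl
∑-const (suc n) c = cong (_+_ c) (∑-const n c)

∑-zero : ∀ {n} {f : Fin n → ℕ} → (∀ i → f i ≡ 0) → ∑[ i < n ] f i ≡ 0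
∑-zero {n} f≡0 = ≡.trans (sum-cong-≗ f≡0) (sum-replicate-zero n)

count-≤1 : ∀ {n} {P : Fin n → Set} (P? : ∀ i → Dec (P i)) →
           (∀ i i' → P i → P i' → i ≡ i') → ∑[ i < n ] 𝟙 (P? i) ≤ 1
count-≤1 {zero} P? unique = z≤n
count-≤1 {suc n} P? unique with P? zero
... | yes p = s≤s (≤-reflexive (∑-zero λ i → 𝟙-no (P? (suc i)) λ q → zero≢suc (unique zero (suc i) p q)))
  where
  zero≢suc : ∀ {i : Fin n} → zero ≢ suc i
  zero≢suc ()
... | no _ = count-≤1 (λ i → P? (suc i)) (λ i i' p q → suc-injective (unique (suc i) (suc i') p q))

-- Fibres of maps between finite sets.

fibre : ∀ {m n} → (Fin m → Fin n) → Fin n → ℕ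
fibre {m} f x = ∑[ t < m ] 𝟙 (x ≟ f t)

∑-select : ∀ {n} (y : Fin n) (g : Fin n → ℕ) → ∑[ x < n ] (𝟙 (x ≟ y) * g x) ≡ g y
∑-select {suc n} zero g =
  ≡.trans (cong₂ _+_ (+-identityʳ (g zero)) (∑-zero {n} (λ _ → refl))) (+-identityʳ (g zero))
∑-select {suc n} (suc y) g = ∑-select y (λ x → g (suc x))

∑-reindex : ∀ {m n} (f : Fin m → Fin n) (g : Fin n → ℕ) →
            ∑[ t < m ] g (f t) ≡ ∑[ x < n ] (fibre f x * g x)
∑-reindex {m} {n} f g = begin
  ∑[ t < m ] g (f t)                           ≡⟨ sum-cong-≗ (λ t → ≡.sym (∑-select (f t) g)) ⟩
  ∑[ t < m ] ∑[ x < n ] (𝟙 (x ≟ f t) * g x)    ≡⟨ ∑-comm (λ t x → 𝟙 (x ≟ f t) * g x) ⟩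
  ∑[ x < n ] ∑[ t < m ] (𝟙 (x ≟ f t) * g x)    ≡⟨ sum-cong-≗ (λ x → ≡.sym (*-distribʳ-sum (g x) (λ t → 𝟙 (x ≟ f t)))) ⟩
  ∑[ x < n ] (fibre f x * g x)                 ∎
  where open ≡-Reasoning

∑-fibre : ∀ {m n} (f : Fin m → Fin n) → ∑[ x < n ] fibre f x ≡ m
∑-fibre {m} {n} f = begin
  ∑[ x < n ] fibre f x         ≡⟨ sum-cong-≗ (λ x → ≡.sym (*-identityʳ (fibre f x))) ⟩
  ∑[ x < n ] (fibre f x * 1)   ≡⟨ ≡.sym (∑-reindex f (λ _ → 1)) ⟩
  ∑[ t < m ] 1                 ≡⟨ ∑-const m 1 ⟩
  m * 1                        ≡⟨ *-identityʳ m ⟩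
  m                            ∎
  where open ≡-Reasoning

fibre-≤1 : ∀ {m n} {f : Fin m → Fin n} → Injective _≡_ _≡_ f → ∀ x → fibre f x ≤ 1
fibre-≤1 {f = f} f-inj x = count-≤1 (λ t → x ≟ f t) (λ t t' p q → f-inj (≡.trans (≡.sym p) q))

∑-injective-≤ : ∀ {m n} {f : Fin m → Fin n} → Injective _≡_ _≡_ f →
                (g : Fin n → ℕ) → ∑[ t < m ] g (f t) ≤ ∑[ x < n ] g x
∑-injective-≤ {m} {n} {f} f-inj g = begin
  ∑[ t < m ] g (f t)            ≡⟨ ∑-reindex f g ⟩
  ∑[ x < n ] (fibre f x * g x)  ≤⟨ ∑-mono (λ x → *-monoˡ-≤ (g x) (fibre-≤1 f-inj x)) ⟩
  ∑[ x < n ] (1 * g x)          ≡⟨ sum-cong-≗ (λ x → *-identityˡ (g x)) ⟩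
  ∑[ x < n ] g x                ∎
  where open ≤-Reasoning

agreements : ∀ {s r N} → (Fin s → Fin N) → (Fin r → Fin N) → ℕ
agreements {s} {r} f h = ∑[ a < s ] ∑[ b < r ] 𝟙 (f a ≟ h b)

+-≤-*-+1 : ∀ {α β} → α ≤ 1 → β ≤ 1 → α + β ≤ α * β + 1
+-≤-*-+1 {zero} _ β≤1 = β≤1
+-≤-*-+1 {suc zero} {zero} _ _ = ≤-refl
+-≤-*-+1 {suc zero} {suc zero} _ _ = ≤-refl
+-≤-*-+1 {suc zero} {suc (suc _)} _ (s≤s ())
+-≤-*-+1 {suc (suc _)} (s≤s ()) _

pigeonhole : ∀ {s r N} {f : Fin s → Fin N} {h : Fin r → Fin N} →
             Injective _≡_ _≡_ f → Injective _≡_ _≡_ h → s + r ≤ agreements f h + N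
pigeonhole {s} {r} {N} {f} {h} f-inj h-inj = begin
  s + r                                           ≡⟨ ≡.sym (cong₂ _+_ (∑-fibre f) (∑-fibre h)) ⟩
  ∑[ x < N ] fibre f x + ∑[ x < N ] fibre h x     ≡⟨ ≡.sym (∑-distrib-+ (fibre f) (fibre h)) ⟩
  ∑[ x < N ] (fibre f x + fibre h x)              ≤⟨ ∑-mono (λ x → +-≤-*-+1 (fibre-≤1 f-inj x) (fibre-≤1 h-inj x)) ⟩
  ∑[ x < N ] (fibre f x * fibre h x + 1)          ≡⟨ ∑-distrib-+ (λ x → fibre f x * fibre h x) (λ _ → 1) ⟩
  ∑[ x < N ] (fibre f x * fibre h x) + ∑[ x < N ] 1
    ≡⟨ cong₂ _+_ (≡.sym (∑-reindex f (fibre h))) (≡.trans (∑-const N 1) (*-identityʳ N)) ⟩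
  agreements f h + N                              ∎
  where open ≤-Reasoning

-- Colourings of cliques.

module _ (G : Graph) where

  proper-injective-on-clique : ∀ {N s} {c : Coloring G N} {A : Fin s → Vertex G} →
    IsProper G c → IsClique G s A → Injective _≡_ _≡_ (λ a → c (A a))
  proper-injective-on-clique c-proper (_ , A-adj) {a} {a'} same =
    decidable-stable (a ≟ a') (λ a≢a' → c-proper _ _ (A-adj a a' a≢a') same)

  shared-colours-≤ : ∀ {k N} (C : Fin k → Coloring G N) →
    (∀ i → IsProper G (C i)) → (∀ i i' → i ≢ i' → Orthogonal G (C i) (C i')) →
    ∀ {u v} → u ≢ v → ∑[ i < k ] 𝟙 (C i u ≟ C i v) ≤ 𝟙 (¬? (dec G u v))
  shared-colours-≤ C proper orth {u} {v} u≢v with dec G u v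
  ... | yes uv = ≤-reflexive (∑-zero λ i → 𝟙-no (C i u ≟ C i v) (proper i u v uv))
  ... | no _ = count-≤1 (λ i → C i u ≟ C i v)
                 (λ i i' same same' → decidable-stable (i ≟ i') λ i≢i' → orth i i' i≢i' u v u≢v same same')

  non-neighbours-bound : ∀ {s j} (A : Fin s → Vertex G) (v : Vertex G) (f : Fin j → Fin s) →
    Injective _≡_ _≡_ f → (∀ t → Adj G v (A (f t))) →
    ∑[ a < s ] 𝟙 (¬? (dec G (A a) v)) + j ≤ s
  non-neighbours-bound {s} {j} A v f f-inj v-adj = begin
    ∑[ a < s ] non-adjacent a + j                        ≤⟨ +-monoʳ-≤ (∑[ a < s ] non-adjacent a) j≤neighbours ⟩
    ∑[ a < s ] non-adjacent a + ∑[ a < s ] adjacent a    ≡⟨ ≡.sym (∑-distrib-+ non-adjacent adjacent) ⟩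
    ∑[ a < s ] (non-adjacent a + adjacent a)             ≡⟨ sum-cong-≗ (λ a → 𝟙-¬?-+-𝟙 (dec G (A a) v)) ⟩
    ∑[ a < s ] 1                                         ≡⟨ ≡.trans (∑-const s 1) (*-identityʳ s) ⟩
    s                                                    ∎
    where
    open ≤-Reasoning
    adjacent non-adjacent : Fin s → ℕ
    adjacent a = 𝟙 (dec G (A a) v)
    non-adjacent a = 𝟙 (¬? (dec G (A a) v))
    j≤neighbours : j ≤ ∑[ a < s ] adjacent a
    j≤neighbours = begin
      j                        ≡⟨ ≡.sym (≡.trans (∑-const j 1) (*-identityʳ j)) ⟩
      ∑[ t < j ] 1             ≡⟨ sum-cong-≗ (λ t → ≡.sym (𝟙-yes (dec G (A (f t)) v) (Graph.sym G (v-adj t)))) ⟩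
      ∑[ t < j ] adjacent (f t) ≤⟨ ∑-injective-≤ f-inj adjacent ⟩
      ∑[ a < s ] adjacent a     ∎

  coincidences : ∀ {k N s r} → (Fin k → Coloring G N) → (Fin s → Vertex G) → (Fin r → Vertex G) → ℕ
  coincidences {k} C A B = ∑[ i < k ] agreements (λ a → C i (A a)) (λ b → C i (B b))

  coincidences-lower : ∀ {k N s r} (C : Fin k → Coloring G N) → (∀ i → IsProper G (C i)) →
    (A : Fin s → Vertex G) → IsClique G s A → (B : Fin r → Vertex G) → IsClique G r B →
    k * (s + r) ≤ coincidences C A B + k * N
  coincidences-lower {k} {N} {s} {r} C proper A A-clique B B-clique = begin
    k * (s + r)                                   ≡⟨ ≡.sym (∑-const k (s + r)) ⟩
    ∑[ i < k ] (s + r)                            ≤⟨ ∑-mono (λ i → pigeonhole (injective-on A-clique i) (injective-on B-clique i)) ⟩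
    ∑[ i < k ] (agreements-of i + N)              ≡⟨ ∑-distrib-+ agreements-of (λ _ → N) ⟩
    coincidences C A B + ∑[ i < k ] N             ≡⟨ cong (_+_ (coincidences C A B)) (∑-const k N) ⟩
    coincidences C A B + k * N                    ∎
    where
    open ≤-Reasoning
    agreements-of : Fin k → ℕ
    agreements-of i = agreements (λ a → C i (A a)) (λ b → C i (B b))
    injective-on : ∀ {t} {X : Fin t → Vertex G} → IsClique G t X → ∀ i → Injective _≡_ _≡_ (λ a → C i (X a))
    injective-on X-clique i = proper-injective-on-clique (proper i) X-clique

  coincidences-upper : ∀ {k N s r j} (C : Fin k → Coloring G N) →
    (∀ i → IsProper G (C i)) → (∀ i i' → i ≢ i' → Orthogonal G (C i) (C i')) →
    (A : Fin s → Vertex G) (B : Fin r → Vertex G) → (∀ a b → A a ≢ B b) →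
    (∀ b → Σ (Fin j → Fin s) λ f → Injective _≡_ _≡_ f × (∀ t → Adj G (B b) (A (f t)))) →
    coincidences C A B + r * j ≤ r * s
  coincidences-upper {k} {N} {s} {r} {j} C proper orth A B disjoint neighbours = begin
    coincidences C A B + r * j                                   ≡⟨ cong (_+ r * j) regroup ⟩
    ∑[ a < s ] ∑[ b < r ] shared a b + r * j                     ≤⟨ +-monoˡ-≤ (r * j) (∑-mono λ a → ∑-mono λ b → shared-colours-≤ C proper orth (disjoint a b)) ⟩
    ∑[ a < s ] ∑[ b < r ] non-adjacent a b + r * j               ≡⟨ cong₂ _+_ (∑-comm non-adjacent) (≡.sym (∑-const r j)) ⟩
    ∑[ b < r ] ∑[ a < s ] non-adjacent a b + ∑[ b < r ] j        ≡⟨ ≡.sym (∑-distrib-+ (λ b → ∑[ a < s ] non-adjacent a b) (λ _ → j)) ⟩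
    ∑[ b < r ] (∑[ a < s ] non-adjacent a b + j)                 ≤⟨ ∑-mono degree-bound ⟩
    ∑[ b < r ] s                                                 ≡⟨ ∑-const r s ⟩
    r * s                                                        ∎
    where
    open ≤-Reasoning
    coincide : Fin k → Fin s → Fin r → ℕ
    coincide i a b = 𝟙 (C i (A a) ≟ C i (B b))
    shared : Fin s → Fin r → ℕ
    shared a b = ∑[ i < k ] coincide i a b
    non-adjacent : Fin s → Fin r → ℕ
    non-adjacent a b = 𝟙 (¬? (dec G (A a) (B b)))
    degree-bound : ∀ b → ∑[ a < s ] non-adjacent a b + j ≤ s
    degree-bound b with neighbours b
    ... | f , f-inj , f-adj = non-neighbours-bound A (B b) f f-inj f-adj
    regroup : coincidences C A B ≡ ∑[ a < s ] ∑[ b < r ] shared a b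
    regroup = ≡.trans (∑-comm (λ i a → ∑[ b < r ] coincide i a b))
                      (sum-cong-≗ λ a → ∑-comm (λ i b → coincide i a b))

  orthogonal-cliques-bound : ∀ {r s j k N}
    → (A : Fin s → Vertex G) → IsClique G s A
    → (B : Fin r → Vertex G) → IsClique G r B
    → (∀ a b → A a ≢ B b)
    → (∀ b → Σ (Fin j → Fin s) λ f → Injective _≡_ _≡_ f × (∀ t → Adj G (B b) (A (f t))))
    → HasOrthColorings G k N
    → k * (r + s) + r * j ≤ k * N + r * s
  orthogonal-cliques-bound {r} {s} {j} {k} {N} A A-clique B B-clique disjoint neighbours (C , proper , orth) = begin
    k * (r + s) + r * j               ≡⟨ cong (λ x → k * x + r * j) (+-comm r s) ⟩
    k * (s + r) + r * j               ≤⟨ +-monoˡ-≤ (r * j) (coincidences-lower C proper A A-clique B B-clique) ⟩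
    T + k * N + r * j                 ≡⟨ +-assoc T (k * N) (r * j) ⟩
    T + (k * N + r * j)               ≡⟨ cong (_+_ T) (+-comm (k * N) (r * j)) ⟩
    T + (r * j + k * N)               ≡⟨ ≡.sym (+-assoc T (r * j) (k * N)) ⟩
    T + r * j + k * N                 ≤⟨ +-monoˡ-≤ (k * N) (coincidences-upper C proper orth A B disjoint neighbours) ⟩
    r * s + k * N                     ≡⟨ +-comm (r * s) (k * N) ⟩
    k * N + r * s                     ∎
    where
    open ≤-Reasoning
    T : ℕ
    T = coincidences C A B

-- Rounding rationals.

floor-≥ : ∀ (m : ℤ) (p : ℚ) → m ℤ.* ↧ p ℤ.≤ ↥ p → m ℤ.≤ ℚ.⌊ p ⌋
floor-≥ m (ℚ.mkℚ n d-1 _) m*d≤n = begin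
  m                   ≤⟨ ℤP.i<j⇒i≤pred[j] m<1+q ⟩
  ℤ.pred (ℤ.suc q)    ≡⟨ ℤP.pred-suc q ⟩
  q                   ≡⟨ ≡.sym (div-pos-is-/ℕ n d) ⟩
  n ℤ./ + d           ∎
  where
  open ℤP.≤-Reasoning
  d : ℕ
  d = suc d-1
  q : ℤ
  q = n ℤ./ℕ d
  m<1+q : m ℤ.< ℤ.suc q
  m<1+q = ℤP.*-cancelʳ-<-nonNeg (+ d) (ℤP.≤-<-trans m*d≤n (n<s[n/ℕd]*d n d))

-- ⌈ q ⌉ ≤ N for every integer N with q ≤ N (stated cross-multiplied),
-- since ⌈ q ⌉ = - ⌊ - q ⌋.
ceiling-≤ : ∀ (q : ℚ) (N : ℤ) → ↥ q ℤ.≤ N ℤ.* ↧ q → ℚ.⌈ q ⌉ ℤ.≤ N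
ceiling-≤ q@(ℚ.mkℚ _ _ _) N q≤N = begin
  ℤ.- ℚ.⌊ ℚ.- q ⌋   ≤⟨ ℤP.neg-mono-≤ (floor-≥ (ℤ.- N) (ℚ.- q) -N≤-q) ⟩
  ℤ.- (ℤ.- N)       ≡⟨ ℤP.neg-involutive N ⟩
  N                 ∎
  where
  open ℤP.≤-Reasoning
  -N≤-q : ℤ.- N ℤ.* ↧ (ℚ.- q) ℤ.≤ ↥ (ℚ.- q)
  -N≤-q = subst₂ ℤ._≤_
    (≡.trans (ℤP.neg-distribˡ-* N (↧ q)) (cong (ℤ._*_ (ℤ.- N)) (≡.sym (ℚP.↧-neg q))))
    (≡.sym (ℚP.↥-neg q))
    (ℤP.neg-mono-≤ q≤N)

fraction-≤ : ∀ (q : ℚ) (u : ℤ) (e : ℕ) (N : ℤ) →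
             ℚ.toℚᵘ q ℚᵘ.≃ mkℚᵘ u e → u ℤ.≤ N ℤ.* + suc e → ↥ q ℤ.≤ N ℤ.* ↧ q
fraction-≤ q u e N (*≡* cross) u≤N·E = ℤP.*-cancelʳ-≤-pos (↥ q) (N ℤ.* ↧ q) E (begin
  ↥ q ℤ.* E             ≡⟨ cross′ ⟩
  u ℤ.* ↧ q             ≤⟨ ℤP.*-monoʳ-≤-nonNeg (↧ q) u≤N·E ⟩
  N ℤ.* E ℤ.* ↧ q       ≡⟨ ℤP.*-assoc N E (↧ q) ⟩
  N ℤ.* (E ℤ.* ↧ q)     ≡⟨ cong (ℤ._*_ N) (ℤP.*-comm E (↧ q)) ⟩
  N ℤ.* (↧ q ℤ.* E)     ≡⟨ ≡.sym (ℤP.*-assoc N (↧ q) E) ⟩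
  N ℤ.* ↧ q ℤ.* E       ∎)
  where
  open ℤP.≤-Reasoning
  E : ℤ
  E = + suc e
  cross′ : ↥ q ℤ.* E ≡ u ℤ.* ↧ q
  cross′ = subst₂ (λ a b → a ℤ.* E ≡ u ℤ.* b) (ℚP.↥ᵘ-toℚᵘ q) (ℚP.↧ᵘ-toℚᵘ q) cross

ceiling-sum-≤ : ∀ (x y N : ℤ) (k-1 : ℕ) → x ℤ.* + suc k-1 ℤ.+ y ℤ.≤ N ℤ.* + suc k-1 →
                ℚ.⌈ x / 1 ℚ.+ y / suc k-1 ⌉ ℤ.≤ N
ceiling-sum-≤ x y N k-1 xK+y≤NK = ceiling-≤ q N (fraction-≤ q _ (k-1 + 0) N q≃sum bound)
  where
  q : ℚ
  q = x / 1 ℚ.+ y / suc k-1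
  -- x / 1 and y / K are the normalisations of the unnormalised fractions.
  q≃sum : ℚ.toℚᵘ q ℚᵘ.≃ mkℚᵘ x 0 ℚᵘ.+ mkℚᵘ y k-1
  q≃sum = ℚᵘP.≃-trans (ℚP.toℚᵘ-homo-+ (x / 1) (y / suc k-1))
            (ℚᵘP.+-cong (ℚP.toℚᵘ-fromℚᵘ (mkℚᵘ x 0)) (ℚP.toℚᵘ-fromℚᵘ (mkℚᵘ y k-1)))
  bound : x ℤ.* + suc k-1 ℤ.+ y ℤ.* + 1 ℤ.≤ N ℤ.* + suc (k-1 + 0)
  bound = subst₂ ℤ._≤_
    (cong (ℤ._+_ (x ℤ.* + suc k-1)) (≡.sym (ℤP.*-identityʳ y)))
    (cong (λ e → N ℤ.* + suc e) (≡.sym (+-identityʳ k-1)))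
    xK+y≤NK

ℕ-bound-in-ℤ : ∀ a b c K N → K * a + b ≤ K * N + c →
               + a ℤ.* + K ℤ.+ (+ b ℤ.- + c) ℤ.≤ + N ℤ.* + K
ℕ-bound-in-ℤ a b c K N Ka+b≤KN+c = begin
  + a ℤ.* + K ℤ.+ (+ b ℤ.- + c)       ≡⟨ solve 4 (λ a K b c → a :* K :+ (b :- c) := K :* a :+ b :- c) refl (+ a) (+ K) (+ b) (+ c) ⟩
  + K ℤ.* + a ℤ.+ + b ℤ.- + c         ≡⟨ cong (ℤ._- + c) (≡.sym (embed K a b)) ⟩
  + (K * a + b) ℤ.- + c               ≤⟨ ℤP.+-monoˡ-≤ (ℤ.- + c) (ℤ.+≤+ Ka+b≤KN+c) ⟩
  + (K * N + c) ℤ.- + c               ≡⟨ cong (ℤ._- + c) (embed K N c) ⟩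
  + K ℤ.* + N ℤ.+ + c ℤ.- + c         ≡⟨ solve 3 (λ K N c → K :* N :+ c :- c := N :* K) refl (+ K) (+ N) (+ c) ⟩
  + N ℤ.* + K                         ∎
  where
  open ℤP.≤-Reasoning
  open +-*-Solver
  embed : ∀ m n p → + (m * n + p) ≡ + m ℤ.* + n ℤ.+ + p
  embed m n p = ≡.trans (ℤP.pos-+ (m * n) p) (cong (ℤ._+ + p) (ℤP.pos-* m n))

corollary2p8 : (G : Graph) (r s j k : ℕ) .{{_ : NonZero k}}
    → (A : Fin s → Vertex G) → IsClique G s A
    → (B : Fin r → Vertex G) → IsClique G r B
    → (∀ i l → A i ≢ B l)
    → (∀ l → Σ (Fin j → Fin s) λ f →
         Injective _≡_ _≡_ f × (∀ t → Adj G (B l) (A (f t))))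
    → (N : ℕ) → IsOrthChromatic G k N
    → N < r + s
    → ℚ.⌈ (+ (r + s)) / 1 ℚ.+ ((+ (r * j)) ℤ.- (+ (r * s))) / k ⌉ ℤ.≤ + N
corollary2p8 G r s j (suc k-1) A A-clique B B-clique disjoint neighbours N (colourings , _) _ =
  ceiling-sum-≤ (+ (r + s)) (+ (r * j) ℤ.- + (r * s)) (+ N) k-1
    (ℕ-bound-in-ℤ (r + s) (r * j) (r * s) (suc k-1) N
      (orthogonal-cliques-bound G A A-clique B B-clique disjoint neighbours colourings))
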